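{- Let $m \ge 1$ and $0 \leq i \leq m$. Let $\frac{r}{s} > \frac{a}{b} \geq 1$ be rational numbers, and write $r^q_{i,m}\left(\frac{r}{s}\right) = \frac{\mathcal{R}(q)}{\mathcal{S}(q)}$ and $r^q_{i,m}\left(\frac{a}{b}\right) = \frac{\mathcal{A}(q)}{\mathcal{B}(q)}$, where $\mathcal{R}(q) = \Omega_m^{m+1-i,1}(\mathcal{G}(r/s),q)$, $\mathcal{S}(q) = \Omega_m^{m+1,1}(\mathcal{G}(r/s),q)$, $\mathcal{A}(q) = \Omega_m^{m+1-i,1}(\mathcal{G}(a/b),q)$, $\mathcal{B}(q) = \Omega_m^{m+1,1}(\mathcal{G}(a/b),q)$. Then $\mathcal{R}(q)\mathcal{B}(q) - \mathcal{A}(q)\mathcal{S}(q)$ is a polynomial with positive (i.e. nonnegative) integer coefficients.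
   Context: Border strip: for positive integers $a_1,\dots,a_n$, $\mathcal{G}[a_1,\dots,a_n]$ consists of unit boxes $b_1,\dots,b_N$, $N=a_1+\cdots+a_n-1$. If $n=1$ it is a vertical column of $a_1-1$ boxes indexed bottom to top. If $n\ge 2$, each $b_{t+1}$ is directly above or directly right of $b_t$, with step sequence: $a_1-1$ up, $a_2$ right, $a_3$ up, $a_4$ right, ..., alternating, ending with $a_n-1$ steps (right if $n$ even, up if $n$ odd). For a rational $x\ge 1$ with continued fraction $[a_1,\dots,a_n]$, $\mathcal{G}(x) := \mathcal{G}[a_1,\dots,a_n]$ (independent of the choice of expansion). A $P$-partition with parts at most $m$ is a map $\sigma$ from boxes to $\{0,\dots,m\}$ weakly increasing along rows left to right and along columns top to bottom; its weight is the sum of its values. For $1\le i,j\le m+1$, $\Omega_m^{ij}(\mathcal{G},q) = \sum_\sigma q^{\mathrm{wt}(\sigma)}$ over such $\sigma$ with $\sigma(b_1)\le m+1-i$ and $\sigma(b_N) \le m+1-j$. The higher $q$-continued fraction is $r^q_{i,m}(x) := \Omega_m^{m+1-i,1}(\mathcal{G}(x),q)/\Omega_m^{m+1,1}(\mathcal{G}(x),q)$. -}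

module Defs where

open import Data.Nat using (ℕ; zero; suc; _+_; _*_; _∸_; _≤ᵇ_; _≡ᵇ_)
open import Data.Nat.DivMod using (_/_; _%_)
open import Data.Bool using (Bool; true; false; _∧_; if_then_else_)
open import Data.List using (List; []; _∷_; _++_; replicate; length; filterᵇ; concatMap; map; upTo)
open import Data.Nat.ListAction using (sum)
open import Data.Rational using (ℚ; ↥_; ↧ₙ_)
import Data.Integer as ℤ
open import Relation.Binary.PropositionalEquality using (_≡_)

-- Continued fractions of positive rationals (Euclidean algorithm).
-- cfAux fuel p q : continued fraction [a₁,…,aₙ] of p/q (q > 0),
-- with fuel enough to terminate (q+1 suffices since remainders decrease).

cfAux : ℕ → ℕ → ℕ → List ℕ
cfAux zero    p q       = []
cfAux (suc f) p zero    = []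
cfAux (suc f) p (suc q) with p % suc q
... | zero  = (p / suc q) ∷ []
... | suc r = (p / suc q) ∷ cfAux f (suc q) (suc r)

-- Continued fraction expansion [a₁,…,aₙ] of a rational x ≥ 1 (last term ≥ 2 unless n = 1).
contFrac : ℚ → List ℕ
contFrac x = cfAux (suc (↧ₙ x)) ℤ.∣ ↥ x ∣ (↧ₙ x)

-- Border strips: a strip with N boxes b₁,…,b_N is given by N together with
-- the list of N-1 steps b_t → b_{t+1}.

data Dir : Set where
  up right : Dir

flipDir : Dir → Dir
flipDir up    = right
flipDir right = up

-- blocks after the first: a₂ (right), a₃ (up), …, last block aₙ - 1
tailSteps : Dir → List ℕ → List Dir
tailSteps d []           = []
tailSteps d (x ∷ [])     = replicate (x ∸ 1) d
tailSteps d (x ∷ y ∷ r)  = replicate x d ++ tailSteps (flipDir d) (y ∷ r)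

stripSteps : List ℕ → List Dir
stripSteps []           = []
stripSteps (a ∷ [])     = replicate (a ∸ 2) up          -- column of a₁-1 boxes
stripSteps (a ∷ b ∷ r)  = replicate (a ∸ 1) up ++ tailSteps right (b ∷ r)

record Strip : Set where
  constructor strip
  field
    nBoxes : ℕ
    steps  : List Dir

𝒢[_] : List ℕ → Strip
𝒢[ as ] = strip (sum as ∸ 1) (stripSteps as)

𝒢 : ℚ → Strip
𝒢 x = 𝒢[ contFrac x ]

-- P-partitions with parts ≤ m, represented as the list (σ(b₁),…,σ(b_N)).

allMaps : ℕ → ℕ → List (List ℕ)
allMaps m zero    = [] ∷ []
allMaps m (suc N) = concatMap (λ v → map (v ∷_) (allMaps m N)) (upTo (suc m))

-- weakly increasing along rows (left to right) and columns (top to bottom):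
-- if b_{t+1} is right of b_t then σ(b_t) ≤ σ(b_{t+1});
-- if b_{t+1} is above b_t then σ(b_{t+1}) ≤ σ(b_t).
stepOK : Dir → ℕ → ℕ → Bool
stepOK right u v = u ≤ᵇ v
stepOK up    u v = v ≤ᵇ u

monotone : List Dir → List ℕ → Bool
monotone (d ∷ ds) (u ∷ v ∷ σ) = stepOK d u v ∧ monotone ds (v ∷ σ)
monotone _        _           = true

firstLE : ℕ → List ℕ → Bool
firstLE c []      = true
firstLE c (u ∷ _) = u ≤ᵇ c

lastLE : ℕ → List ℕ → Bool
lastLE c []          = true
lastLE c (u ∷ [])    = u ≤ᵇ c
lastLE c (_ ∷ v ∷ σ) = lastLE c (v ∷ σ)

-- coefficient of q^k in Ω_m^{ij}(G,q): number of P-partitions σ with parts ≤ m,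
-- σ(b₁) ≤ m+1-i, σ(b_N) ≤ m+1-j, and weight k.
Ω : ℕ → ℕ → ℕ → Strip → ℕ → ℕ
Ω m i j (strip N st) k =
  length (filterᵇ (λ σ → (sum σ ≡ᵇ k) ∧ monotone st σ ∧ firstLE (suc m ∸ i) σ ∧ lastLE (suc m ∸ j) σ)
    (allMaps m N))

_⊛_ : (ℕ → ℕ) → (ℕ → ℕ) → ℕ → ℕ
(f ⊛ g) k = sum (map (λ j → f j * g (k ∸ j)) (upTo (suc k)))

module Submission where

-- Write Φ w v for the generating series of the P-partitions of the strip with step word w whose
-- first box has value v. Removing the first box gives Φ (d ∷ w) v = q^v Σ Φ w u, the sum running
-- over the values u allowed after a d-step from v. If w′ ≺ w in the lexicographic order with
-- right < (end of word) < up, then Φ w′ a · Φ w b ≤ Φ w a · Φ w′ b coefficientwise for b < a: when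
-- the first letters differ, one of the two sums grows and the other shrinks with a, and a common
-- first letter is handled by symmetrising the double sum, pairing its terms (u, v) and (v, u).
-- The subtractive Euclid word of x ≥ 1 is empty for x = 1 and is otherwise the step word of 𝒢(x)
-- preceded by one up-step; y < x implies word y ≺ word x. Finally Φ (word x) i is q^i times
-- Ω^{m+1-i,1}(𝒢(x)), so taking a = i and b = 0 gives the theorem.

open import Algebra.Properties.CommutativeSemigroup using (interchange)
open import Data.Bool using (Bool; true; false; _∧_; T)
open import Data.Bool.Properties using (T-∧; T-≡; ∧-commutativeMonoid)
open import Algebra.Solver.CommutativeMonoid ∧-commutativeMonoid using (solve; _⊜_; _⊕_)
import Data.Integer as ℤ
import Data.Integer.Properties as ℤ
open import Data.List using (List; []; _∷_; _++_; map; replicate; concatMap; upTo; length; filterᵇ; drop)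
open import Data.List.Properties
  using (map-cong; map-cong-local; map-∘; map-++; map-applyUpTo; map-replicate; ++-identityʳ; length-replicate;
         length-++; length-map)
open import Data.List.Relation.Unary.All.Properties using (applyUpTo⁺₁)
open import Data.Nat
  using (ℕ; zero; suc; _+_; _*_; _∸_; _≤_; _<_; _≤ᵇ_; _<ᵇ_; _≡ᵇ_; z≤n; s≤s; z<s; >-nonZero)
open import Data.Nat.DivMod using (_/_; _%_; m≥n⇒m/n>0; m≡m%n+[m/n]*n; m%n<n)
open import Data.Nat.ListAction using (sum)
open import Data.Nat.ListAction.Properties using (sum-++)
open import Data.Nat.Properties
open import Data.Nat.Tactic.RingSolver using (solve-∀)
open import Data.Product using (_×_; _,_; proj₁; proj₂)
open import Data.Rational using (ℚ; 1ℚ; ↥_; ↧ₙ_; mkℚ; *≤*; *<*) renaming (_≤_ to _≤ℚ_; _<_ to _<ℚ_)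
import Data.Rational.Properties as ℚ
open import Function using (_∘_; id; Equivalence)
open import Relation.Binary.Definitions using (tri<; tri≈; tri>)
open import Relation.Binary.PropositionalEquality
open import Relation.Nullary using (¬_; contradiction)

open import Defs

open ≡-Reasoning

private
  variable
    A B : Set

-- Finite sums

∑ : List A → (A → ℕ) → ℕ
∑ xs f = sum (map f xs)

∑-cong : ∀ xs {f g : A → ℕ} → f ≗ g → ∑ xs f ≡ ∑ xs g
∑-cong xs f≗g = cong sum (map-cong f≗g xs)

∑-mono : ∀ xs {f g : A → ℕ} → (∀ x → f x ≤ g x) → ∑ xs f ≤ ∑ xs g
∑-mono []       f≤g = z≤n
∑-mono (x ∷ xs) f≤g = +-mono-≤ (f≤g x) (∑-mono xs f≤g)

∑-zero : ∀ xs → ∑ xs (λ (_ : A) → 0) ≡ 0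
∑-zero []       = refl
∑-zero (x ∷ xs) = ∑-zero xs

∑-+ : ∀ xs (f g : A → ℕ) → ∑ xs (λ x → f x + g x) ≡ ∑ xs f + ∑ xs g
∑-+ []       f g = refl
∑-+ (x ∷ xs) f g = begin
  f x + g x + ∑ xs (λ x → f x + g x) ≡⟨ cong (f x + g x +_) (∑-+ xs f g) ⟩
  f x + g x + (∑ xs f + ∑ xs g)      ≡⟨ interchange +-commutativeSemigroup (f x) (g x) _ _ ⟩
  f x + ∑ xs f + (g x + ∑ xs g)      ∎

∑-swap : ∀ xs (ys : List B) (h : A → B → ℕ) →
         ∑ xs (λ x → ∑ ys (h x)) ≡ ∑ ys (λ y → ∑ xs (λ x → h x y))
∑-swap []       ys h = sym (∑-zero ys)
∑-swap (x ∷ xs) ys h = begin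
  ∑ ys (h x) + ∑ xs (λ x → ∑ ys (h x))         ≡⟨ cong (∑ ys (h x) +_) (∑-swap xs ys h) ⟩
  ∑ ys (h x) + ∑ ys (λ y → ∑ xs (λ x → h x y)) ≡⟨ sym (∑-+ ys (h x) _) ⟩
  ∑ ys (λ y → h x y + ∑ xs (λ x → h x y))      ∎

∑-*ʳ : ∀ xs (f : A → ℕ) c → ∑ xs f * c ≡ ∑ xs (λ x → f x * c)
∑-*ʳ []       f c = refl
∑-*ʳ (x ∷ xs) f c = trans (*-distribʳ-+ c (f x) _) (cong (f x * c +_) (∑-*ʳ xs f c))

∑-++ : ∀ xs ys (f : A → ℕ) → ∑ (xs ++ ys) f ≡ ∑ xs f + ∑ ys f
∑-++ xs ys f = trans (cong sum (map-++ f xs ys)) (sum-++ (map f xs) (map f ys))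

∑-concatMap : ∀ xs (g : A → List B) (f : B → ℕ) → ∑ (concatMap g xs) f ≡ ∑ xs (λ x → ∑ (g x) f)
∑-concatMap []       g f = refl
∑-concatMap (x ∷ xs) g f =
  trans (∑-++ (g x) (concatMap g xs) f) (cong (∑ (g x) f +_) (∑-concatMap xs g f))

∑-map : ∀ xs (g : A → B) (f : B → ℕ) → ∑ (map g xs) f ≡ ∑ xs (f ∘ g)
∑-map xs g f = cong sum (sym (map-∘ xs))

m+m≤n+n⇒m≤n : ∀ {m n} → m + m ≤ n + n → m ≤ n
m+m≤n+n⇒m≤n m+m≤n+n = ≮⇒≥ (λ n<m → <⇒≱ (+-mono-< n<m n<m) m+m≤n+n)

∑∑-mono-symmetric : ∀ (xs : List A) (w w′ : A → A → ℕ) →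
                    (∀ x y → w x y + w y x ≤ w′ x y + w′ y x) →
                    ∑ xs (λ x → ∑ xs (w x)) ≤ ∑ xs (λ x → ∑ xs (w′ x))
∑∑-mono-symmetric {A} xs w w′ pair≤ =
  m+m≤n+n⇒m≤n (subst₂ _≤_ (symmetrised w) (symmetrised w′)
    (∑-mono xs (λ x → ∑-mono xs (pair≤ x))))
  where
  ∑∑ : (A → A → ℕ) → ℕ
  ∑∑ v = ∑ xs (λ x → ∑ xs (v x))

  symmetrised : (v : A → A → ℕ) →
    ∑ xs (λ x → ∑ xs (λ y → v x y + v y x)) ≡ ∑∑ v + ∑∑ v
  symmetrised v = begin
    ∑ xs (λ x → ∑ xs (λ y → v x y + v y x))      ≡⟨ ∑-cong xs (λ x → ∑-+ xs (v x) (λ y → v y x)) ⟩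
    ∑ xs (λ x → ∑ xs (v x) + ∑ xs (λ y → v y x)) ≡⟨ ∑-+ xs _ _ ⟩
    ∑∑ v + ∑ xs (λ x → ∑ xs (λ y → v y x))       ≡⟨ cong (∑∑ v +_) (sym (∑-swap xs xs v)) ⟩
    ∑∑ v + ∑∑ v                                  ∎

_⋆_ : Bool → ℕ → ℕ
true  ⋆ n = n
false ⋆ n = 0

⋆-∧ : ∀ a b n → a ⋆ (b ⋆ n) ≡ (a ∧ b) ⋆ n
⋆-∧ true  b n = refl
⋆-∧ false b n = refl

⋆-*ˡ : ∀ b m n → (b ⋆ m) * n ≡ b ⋆ (m * n)
⋆-*ˡ true  m n = refl
⋆-*ˡ false m n = refl

⋆-∑ : ∀ b xs (f : A → ℕ) → b ⋆ ∑ xs f ≡ ∑ xs (λ x → b ⋆ f x)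
⋆-∑ true  xs f = refl
⋆-∑ false xs f = sym (∑-zero xs)

⋆-mono : ∀ {a b} n → (T a → T b) → a ⋆ n ≤ b ⋆ n
⋆-mono {true}  {true}  n a⇒b = ≤-refl
⋆-mono {true}  {false} n a⇒b with () ← a⇒b _
⋆-mono {false}         n a⇒b = z≤n

⋆-swap-≤ : ∀ α β {s t} → s ≤ t → (T β → T α) → α ⋆ s + β ⋆ t ≤ α ⋆ t + β ⋆ s
⋆-swap-≤ true  true  {s} {t} s≤t β⇒α = ≤-reflexive (+-comm s t)
⋆-swap-≤ true  false         s≤t β⇒α = +-monoˡ-≤ 0 s≤t
⋆-swap-≤ false true          s≤t β⇒α with () ← β⇒α _
⋆-swap-≤ false false         s≤t β⇒α = z≤n

length-filterᵇ : ∀ (P : A → Bool) xs → length (filterᵇ P xs) ≡ ∑ xs (λ x → P x ⋆ 1)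
length-filterᵇ P []       = refl
length-filterᵇ P (x ∷ xs) with P x
... | true  = cong suc (length-filterᵇ P xs)
... | false = length-filterᵇ P xs

-- Coefficient sequences of power series in q

Series : Set
Series = ℕ → ℕ

infix 4 _≤ₛ_
_≤ₛ_ : Series → Series → Set
f ≤ₛ g = ∀ k → f k ≤ g k

δ : Series
δ zero    = 1
δ (suc _) = 0

⊛-zero : ∀ f g → (f ⊛ g) 0 ≡ f 0 * g 0
⊛-zero f g = +-identityʳ _

⊛-suc : ∀ f g k → (f ⊛ g) (suc k) ≡ f 0 * g (suc k) + ((f ∘ suc) ⊛ g) k
⊛-suc f g k = cong (λ s → f 0 * g (suc k) + sum s)
  (trans (map-applyUpTo suc (λ j → f j * g (suc k ∸ j)) (suc k))
         (sym (map-applyUpTo id (λ j → f (suc j) * g (k ∸ j)) (suc k))))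

⊛-sucʳ : ∀ f g k → (f ⊛ g) (suc k) ≡ (f ⊛ (g ∘ suc)) k + f (suc k) * g 0
⊛-sucʳ f g zero = begin
  (f ⊛ g) 1                     ≡⟨ ⊛-suc f g 0 ⟩
  f 0 * g 1 + ((f ∘ suc) ⊛ g) 0 ≡⟨ cong (f 0 * g 1 +_) (⊛-zero (f ∘ suc) g) ⟩
  f 0 * g 1 + f 1 * g 0         ≡⟨ cong (_+ f 1 * g 0) (sym (⊛-zero f (g ∘ suc))) ⟩
  (f ⊛ (g ∘ suc)) 0 + f 1 * g 0 ∎
⊛-sucʳ f g (suc k) = begin
  (f ⊛ g) (2 + k)
    ≡⟨ ⊛-suc f g (suc k) ⟩
  f 0 * g (2 + k) + ((f ∘ suc) ⊛ g) (suc k)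
    ≡⟨ cong (f 0 * g (2 + k) +_) (⊛-sucʳ (f ∘ suc) g k) ⟩
  f 0 * g (2 + k) + (((f ∘ suc) ⊛ (g ∘ suc)) k + f (2 + k) * g 0)
    ≡⟨ sym (+-assoc (f 0 * g (2 + k)) _ _) ⟩
  f 0 * g (2 + k) + ((f ∘ suc) ⊛ (g ∘ suc)) k + f (2 + k) * g 0
    ≡⟨ cong (_+ f (2 + k) * g 0) (sym (⊛-suc f (g ∘ suc) k)) ⟩
  (f ⊛ (g ∘ suc)) (suc k) + f (2 + k) * g 0
    ∎

⊛-comm : ∀ f g → f ⊛ g ≗ g ⊛ f
⊛-comm f g zero = begin
  (f ⊛ g) 0 ≡⟨ ⊛-zero f g ⟩
  f 0 * g 0 ≡⟨ *-comm (f 0) (g 0) ⟩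
  g 0 * f 0 ≡⟨ sym (⊛-zero g f) ⟩
  (g ⊛ f) 0 ∎
⊛-comm f g (suc k) = begin
  (f ⊛ g) (suc k)                     ≡⟨ ⊛-suc f g k ⟩
  f 0 * g (suc k) + ((f ∘ suc) ⊛ g) k ≡⟨ cong₂ _+_ (*-comm (f 0) (g (suc k))) (⊛-comm (f ∘ suc) g k) ⟩
  g (suc k) * f 0 + (g ⊛ (f ∘ suc)) k ≡⟨ +-comm (g (suc k) * f 0) _ ⟩
  (g ⊛ (f ∘ suc)) k + g (suc k) * f 0 ≡⟨ sym (⊛-sucʳ g f k) ⟩
  (g ⊛ f) (suc k)                     ∎

⊛-congˡ : ∀ {f f′} g → f ≗ f′ → f ⊛ g ≗ f′ ⊛ g
⊛-congˡ g f≗f′ k = ∑-cong (upTo (suc k)) (λ j → cong (_* g (k ∸ j)) (f≗f′ j))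

⊛-congʳ : ∀ f {g g′} → g ≗ g′ → f ⊛ g ≗ f ⊛ g′
⊛-congʳ f g≗g′ k = ∑-cong (upTo (suc k)) (λ j → cong (f j *_) (g≗g′ (k ∸ j)))

⊛-mono : ∀ {f f′ g g′} → f ≤ₛ f′ → g ≤ₛ g′ → f ⊛ g ≤ₛ f′ ⊛ g′
⊛-mono f≤f′ g≤g′ k = ∑-mono (upTo (suc k)) (λ j → *-mono-≤ (f≤f′ j) (g≤g′ (k ∸ j)))

shift : ℕ → Series → Series
shift zero    f         = f
shift (suc a) f zero    = 0
shift (suc a) f (suc k) = shift a f k

shift-cong : ∀ a {f g} → f ≗ g → shift a f ≗ shift a g
shift-cong zero    f≗g k       = f≗g k
shift-cong (suc a) f≗g zero    = refl
shift-cong (suc a) f≗g (suc k) = shift-cong a f≗g k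

shift-mono : ∀ a {f g} → f ≤ₛ g → shift a f ≤ₛ shift a g
shift-mono zero    f≤g k       = f≤g k
shift-mono (suc a) f≤g zero    = z≤n
shift-mono (suc a) f≤g (suc k) = shift-mono a f≤g k

shift-+ : ∀ a f k → shift a f (a + k) ≡ f k
shift-+ zero    f k = refl
shift-+ (suc a) f k = shift-+ a f k

shift-cancel : ∀ a {f g} → shift a f ≤ₛ shift a g → f ≤ₛ g
shift-cancel a {f} {g} sf≤sg k = subst₂ _≤_ (shift-+ a f k) (shift-+ a g k) (sf≤sg (a + k))

shift-≤ᵇ : ∀ a f k → shift a f k ≡ (a ≤ᵇ k) ⋆ f (k ∸ a)
shift-≤ᵇ zero          f k       = refl
shift-≤ᵇ (suc a)       f zero    = refl
shift-≤ᵇ (suc zero)    f (suc k) = refl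
shift-≤ᵇ (suc (suc a)) f (suc k) = shift-≤ᵇ (suc a) f k

shift-δ : ∀ a k → shift a δ k ≡ (a ≡ᵇ k) ⋆ 1
shift-δ zero    zero    = refl
shift-δ zero    (suc k) = refl
shift-δ (suc a) zero    = refl
shift-δ (suc a) (suc k) = shift-δ a k

⊛-shiftˡ : ∀ a f g → shift a f ⊛ g ≗ shift a (f ⊛ g)
⊛-shiftˡ zero    f g k       = refl
⊛-shiftˡ (suc a) f g zero    = ⊛-zero (shift (suc a) f) g
⊛-shiftˡ (suc a) f g (suc k) = trans (⊛-suc (shift (suc a) f) g k) (⊛-shiftˡ a f g k)

⊛-shift : ∀ a b f g → shift a f ⊛ shift b g ≗ shift a (shift b (f ⊛ g))
⊛-shift a b f g k = begin
  (shift a f ⊛ shift b g) k   ≡⟨ ⊛-shiftˡ a f (shift b g) k ⟩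
  shift a (f ⊛ shift b g) k   ≡⟨ shift-cong a (λ j → trans (⊛-comm f (shift b g) j) (⊛-shiftˡ b g f j)) k ⟩
  shift a (shift b (g ⊛ f)) k ≡⟨ shift-cong a (shift-cong b (⊛-comm g f)) k ⟩
  shift a (shift b (f ⊛ g)) k ∎

-- Increasing ratios

sumIf : List ℕ → (ℕ → Bool) → (ℕ → Series) → Series
sumIf us P f k = ∑ us (λ u → P u ⋆ f u k)

sumIf-mono : ∀ us {P Q} f → (∀ u → T (P u) → T (Q u)) → sumIf us P f ≤ₛ sumIf us Q f
sumIf-mono us f P⇒Q k = ∑-mono us (λ u → ⋆-mono (f u k) (P⇒Q u))

sumIf-⊛ : ∀ us P f g k → (sumIf us P f ⊛ g) k ≡ ∑ us (λ u → P u ⋆ (f u ⊛ g) k)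
sumIf-⊛ us P f g k = begin
  ∑ js (λ j → ∑ us (λ u → P u ⋆ f u j) * g (k ∸ j))
    ≡⟨ ∑-cong js (λ j → trans (∑-*ʳ us _ _) (∑-cong us (λ u → ⋆-*ˡ (P u) (f u j) _))) ⟩
  ∑ js (λ j → ∑ us (λ u → P u ⋆ (f u j * g (k ∸ j))))
    ≡⟨ ∑-swap js us _ ⟩
  ∑ us (λ u → ∑ js (λ j → P u ⋆ (f u j * g (k ∸ j))))
    ≡⟨ ∑-cong us (λ u → sym (⋆-∑ (P u) js _)) ⟩
  ∑ us (λ u → P u ⋆ (f u ⊛ g) k)
    ∎
  where
  js : List ℕ
  js = upTo (suc k)

sumIf-⊛-sumIf : ∀ us vs P Q f g k →
  (sumIf us P f ⊛ sumIf vs Q g) k ≡ ∑ us (λ u → ∑ vs (λ v → (P u ∧ Q v) ⋆ (f u ⊛ g v) k))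
sumIf-⊛-sumIf us vs P Q f g k = trans (sumIf-⊛ us P f (sumIf vs Q g) k) (∑-cong us expand)
  where
  expand : ∀ u → P u ⋆ (f u ⊛ sumIf vs Q g) k ≡ ∑ vs (λ v → (P u ∧ Q v) ⋆ (f u ⊛ g v) k)
  expand u = begin
    P u ⋆ (f u ⊛ sumIf vs Q g) k
      ≡⟨ cong (P u ⋆_) (trans (⊛-comm (f u) (sumIf vs Q g) k) (sumIf-⊛ vs Q g (f u) k)) ⟩
    P u ⋆ ∑ vs (λ v → Q v ⋆ (g v ⊛ f u) k)
      ≡⟨ ⋆-∑ (P u) vs _ ⟩
    ∑ vs (λ v → P u ⋆ (Q v ⋆ (g v ⊛ f u) k))
      ≡⟨ ∑-cong vs (λ v → trans (⋆-∧ (P u) (Q v) _)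
                                 (cong ((P u ∧ Q v) ⋆_) (⊛-comm (g v) (f u) k))) ⟩
    ∑ vs (λ v → (P u ∧ Q v) ⋆ (f u ⊛ g v) k)
      ∎

SwapClosed : (P Q : ℕ → Bool) → Set
SwapClosed P Q = ∀ {u v} → v < u → T (P v) → T (Q u) → T (P u) × T (Q v)

-- Coefficientwise, X a / Y a increases with a.
RatioMonotone : (X Y : ℕ → Series) → Set
RatioMonotone X Y = ∀ {a b} → b < a → Y a ⊛ X b ≤ₛ X a ⊛ Y b

sumIf-ratio-≤ : ∀ us {P Q X Y} → SwapClosed P Q → RatioMonotone X Y →
                sumIf us P Y ⊛ sumIf us Q X ≤ₛ sumIf us P X ⊛ sumIf us Q Y
sumIf-ratio-≤ us {P} {Q} {X} {Y} closed ratio k =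
  subst₂ _≤_ (sym (sumIf-⊛-sumIf us us P Q Y X k)) (sym (sumIf-⊛-sumIf us us P Q X Y k))
    (∑∑-mono-symmetric us w w′ pair≤)
  where
  w w′ : ℕ → ℕ → ℕ
  w  u v = (P u ∧ Q v) ⋆ (Y u ⊛ X v) k
  w′ u v = (P u ∧ Q v) ⋆ (X u ⊛ Y v) k

  ordered≤ : ∀ {u v} → v < u → w u v + w v u ≤ w′ u v + w′ v u
  ordered≤ {u} {v} v<u =
    subst₂ (λ s t → w u v + (P v ∧ Q u) ⋆ s ≤ w′ u v + (P v ∧ Q u) ⋆ t)
      (⊛-comm (X u) (Y v) k) (⊛-comm (Y u) (X v) k)
      (⋆-swap-≤ (P u ∧ Q v) (P v ∧ Q u) (ratio v<u k) swapped)
    where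
    swapped : T (P v ∧ Q u) → T (P u ∧ Q v)
    swapped pq with pv , qu ← Equivalence.to T-∧ pq = Equivalence.from T-∧ (closed v<u pv qu)

  pair≤ : ∀ u v → w u v + w v u ≤ w′ u v + w′ v u
  pair≤ u v with <-cmp u v
  ... | tri< u<v _ _  = subst₂ _≤_ (+-comm (w v u) (w u v)) (+-comm (w′ v u) (w′ u v)) (ordered≤ u<v)
  ... | tri≈ _ refl _ = ≤-reflexive (cong (λ c → c + c) (cong ((P u ∧ Q u) ⋆_) (⊛-comm (Y u) (X u) k)))
  ... | tri> _ _ v<u  = ordered≤ v<u

RatioMonotone-shift : ∀ {X Y : ℕ → Series} → RatioMonotone X Y →
                      RatioMonotone (λ a → shift a (X a)) (λ a → shift a (Y a))
RatioMonotone-shift {X} {Y} ratio {a} {b} b<a k =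
  subst₂ _≤_ (sym (⊛-shift a b (Y a) (X b) k)) (sym (⊛-shift a b (X a) (Y b) k))
    (shift-mono a (shift-mono b (ratio b<a)) k)

mono-anti⇒RatioMonotone : ∀ {X Y : ℕ → Series} →
  (∀ {a b} → b < a → X b ≤ₛ X a) → (∀ {a b} → b < a → Y a ≤ₛ Y b) → RatioMonotone X Y
mono-anti⇒RatioMonotone {X} {Y} X-mono Y-anti {a} {b} b<a k =
  subst ((Y a ⊛ X b) k ≤_) (⊛-comm (Y b) (X a) k) (⊛-mono (Y-anti b<a) (X-mono b<a) k)

RatioMonotone-unshift : ∀ {n} {X Y X′ Y′ : ℕ → Series} → RatioMonotone X Y →
  (∀ {c} → c ≤ n → X c ≗ shift c (X′ c)) → (∀ {c} → c ≤ n → Y c ≗ shift c (Y′ c)) →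
  ∀ {a} → a ≤ n → Y′ a ⊛ X′ 0 ≤ₛ X′ a ⊛ Y′ 0
RatioMonotone-unshift {X′ = X′} {Y′} ratio X≗ Y≗ {zero} _ k = ≤-reflexive (⊛-comm (Y′ 0) (X′ 0) k)
RatioMonotone-unshift {n} ratio X≗ Y≗ {suc a} a≤n =
  shift-cancel (suc a) (λ k → subst₂ _≤_ (unshifted Y≗ X≗ k) (unshifted X≗ Y≗ k) (ratio z<s k))
  where
  unshifted : ∀ {Z W Z′ W′ : ℕ → Series} →
    (∀ {c} → c ≤ n → Z c ≗ shift c (Z′ c)) → (∀ {c} → c ≤ n → W c ≗ shift c (W′ c)) →
    Z (suc a) ⊛ W 0 ≗ shift (suc a) (Z′ (suc a) ⊛ W′ 0)
  unshifted {Z} {W} {Z′} {W′} Z≗ W≗ k =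
    trans (⊛-congˡ (W 0) (Z≗ a≤n) k)
      (trans (⊛-congʳ (shift (suc a) (Z′ (suc a))) (W≗ z≤n) k)
             (⊛-shiftˡ (suc a) (Z′ (suc a)) (W′ 0) k))

stepOK-swapClosed : ∀ d {a b} → b < a → SwapClosed (stepOK d a) (stepOK d b)
stepOK-swapClosed up {a} {b} b<a {u} {v} v<u _ u≤b =
  ≤⇒≤ᵇ (≤-trans u≤b′ (<⇒≤ b<a)) , ≤⇒≤ᵇ (≤-trans (<⇒≤ v<u) u≤b′)
  where
  u≤b′ : u ≤ b
  u≤b′ = ≤ᵇ⇒≤ u b u≤b
stepOK-swapClosed right {a} {b} b<a {u} {v} v<u a≤v _ =
  ≤⇒≤ᵇ (≤-trans a≤v′ (<⇒≤ v<u)) , ≤⇒≤ᵇ (≤-trans (<⇒≤ b<a) a≤v′)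
  where
  a≤v′ : a ≤ v
  a≤v′ = ≤ᵇ⇒≤ a v a≤v

sumIf-up-mono : ∀ us f {a b} → b < a → sumIf us (stepOK up b) f ≤ₛ sumIf us (stepOK up a) f
sumIf-up-mono us f {a} {b} b<a =
  sumIf-mono us f (λ u u≤b → ≤⇒≤ᵇ (≤-trans (≤ᵇ⇒≤ u b u≤b) (<⇒≤ b<a)))

sumIf-right-anti : ∀ us f {a b} → b < a → sumIf us (stepOK right a) f ≤ₛ sumIf us (stepOK right b) f
sumIf-right-anti us f {a} {b} b<a =
  sumIf-mono us f (λ u a≤u → ≤⇒≤ᵇ (≤-trans (<⇒≤ b<a) (≤ᵇ⇒≤ a u a≤u)))

-- Euclid words

-- The subtractive Euclidean algorithm on p/q, recording up when p > q and right when p < q;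
-- g is fuel, and p + q suffices.
euclid : ℕ → ℕ → ℕ → List Dir
euclid zero    p q = []
euclid (suc g) p q with <-cmp p q
... | tri< _ _ _ = right ∷ euclid g p (q ∸ p)
... | tri≈ _ _ _ = []
... | tri> _ _ _ = up ∷ euclid g (p ∸ q) q

euclid-< : ∀ g {p q} → p < q → euclid (suc g) p q ≡ right ∷ euclid g p (q ∸ p)
euclid-< g {p} {q} p<q with <-cmp p q
... | tri< _ _ _   = refl
... | tri≈ p≮q _ _ = contradiction p<q p≮q
... | tri> p≮q _ _ = contradiction p<q p≮q

euclid-> : ∀ g {p q} → q < p → euclid (suc g) p q ≡ up ∷ euclid g (p ∸ q) q
euclid-> g {p} {q} q<p with <-cmp p q
... | tri< _ _ q≮p = contradiction q<p q≮p
... | tri≈ _ _ q≮p = contradiction q<p q≮p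
... | tri> _ _ _   = refl

euclid-≡ : ∀ g p → euclid (suc g) p p ≡ []
euclid-≡ g p with <-cmp p p
... | tri< p<p _ _ = contradiction p<p (<-irrefl refl)
... | tri≈ _ _ _   = refl
... | tri> _ _ p<p = contradiction p<p (<-irrefl refl)

euclid-flip : ∀ g p q → euclid g q p ≡ map flipDir (euclid g p q)
euclid-flip zero    p q = refl
euclid-flip (suc g) p q with <-cmp p q
... | tri< p<q _ _  = trans (euclid-> g p<q) (cong (up ∷_) (euclid-flip g p (q ∸ p)))
... | tri≈ _ refl _ = euclid-≡ g p
... | tri> _ _ q<p  = trans (euclid-< g q<p) (cong (right ∷_) (euclid-flip g (p ∸ q) q))

euclid-up-run : ∀ a {g q r} → 0 < r → a ≤ g →
                euclid g (a * q + r) q ≡ replicate a up ++ euclid (g ∸ a) r q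
euclid-up-run zero    0<r a≤g = refl
euclid-up-run (suc a) {suc g} {q} {r} 0<r (s≤s a≤g) = begin
  euclid (suc g) (q + a * q + r) q          ≡⟨ euclid-> g q<q+aq+r ⟩
  up ∷ euclid g (q + a * q + r ∸ q) q       ≡⟨ cong (λ n → up ∷ euclid g n q) q+aq+r∸q ⟩
  up ∷ euclid g (a * q + r) q               ≡⟨ cong (up ∷_) (euclid-up-run a 0<r a≤g) ⟩
  up ∷ replicate a up ++ euclid (g ∸ a) r q ∎
  where
  q<q+aq+r : q < q + a * q + r
  q<q+aq+r = subst (q <_) (sym (+-assoc q (a * q) r)) (m<m+n q (<-≤-trans 0<r (m≤n+m r (a * q))))
  q+aq+r∸q : q + a * q + r ∸ q ≡ a * q + r
  q+aq+r∸q = trans (cong (_∸ q) (+-assoc q (a * q) r)) (m+n∸m≡n q (a * q + r))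

euclid-multiple : ∀ a {g q} → 0 < q → a * q + q ≤ g → euclid g (a * q + q) q ≡ replicate a up
euclid-multiple a {g} {q} 0<q aq+q≤g = begin
  euclid g (a * q + q) q               ≡⟨ euclid-up-run a 0<q (<⇒≤ a<g) ⟩
  replicate a up ++ euclid (g ∸ a) q q ≡⟨ cong (replicate a up ++_) (euclid-diagonal (m<n⇒0<n∸m a<g)) ⟩
  replicate a up ++ []                 ≡⟨ ++-identityʳ _ ⟩
  replicate a up                       ∎
  where
  a<g : a < g
  a<g = <-≤-trans (≤-<-trans (m≤m*n a q {{>-nonZero 0<q}}) (m<m+n (a * q) 0<q)) aq+q≤g
  euclid-diagonal : ∀ {f} → 0 < f → euclid f q q ≡ []
  euclid-diagonal {suc f} _ = euclid-≡ f q

data UpOrEmpty : List Dir → Set where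
  []  : UpOrEmpty []
  up∷ : ∀ w → UpOrEmpty (up ∷ w)

euclid-UpOrEmpty : ∀ g {p q} → q ≤ p → UpOrEmpty (euclid g p q)
euclid-UpOrEmpty zero    q≤p = []
euclid-UpOrEmpty (suc g) {p} {q} q≤p with <-cmp p q
... | tri< p<q _ _ = contradiction q≤p (<⇒≱ p<q)
... | tri≈ _ _ _   = []
... | tri> _ _ _   = up∷ _

infix 4 _≺_
data _≺_ : List Dir → List Dir → Set where
  step     : ∀ d {ys xs} → ys ≺ xs → d ∷ ys ≺ d ∷ xs
  right≺up : ∀ {ys xs} → right ∷ ys ≺ up ∷ xs
  right≺[] : ∀ {ys} → right ∷ ys ≺ []
  []≺up    : ∀ {xs} → [] ≺ up ∷ xs

cross-contradiction : ∀ {p q p′ q′} → p ≤ q → q′ ≤ p′ → ¬ (p′ * q < p * q′)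
cross-contradiction {p} {q} {p′} {q′} p≤q q′≤p′ cross =
  <⇒≱ cross (≤-trans (*-monoˡ-≤ q′ p≤q)
                     (subst (q * q′ ≤_) (*-comm q p′) (*-monoʳ-≤ q q′≤p′)))

cross-∸ˡ : ∀ {p q p′ q′} → q′ ≤ p′ → p′ * q < p * q′ → (p′ ∸ q′) * q < (p ∸ q) * q′
cross-∸ˡ {p} {q} {p′} {q′} q′≤p′ cross =
  subst₂ _<_ (sym (*-distribʳ-∸ q p′ q′))
             (trans (cong (p * q′ ∸_) (*-comm q′ q)) (sym (*-distribʳ-∸ q′ p q)))
    (∸-monoˡ-< cross (*-monoˡ-≤ q q′≤p′))

cross-∸ʳ : ∀ {p q p′ q′} → p ≤ q → p′ * q < p * q′ → p′ * (q ∸ p) < p * (q′ ∸ p′)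
cross-∸ʳ {p} {q} {p′} {q′} p≤q cross =
  subst₂ _<_ (sym (*-distribˡ-∸ p′ q p))
             (trans (cong (p * q′ ∸_) (*-comm p′ p)) (sym (*-distribˡ-∸ p q′ p′)))
    (∸-monoˡ-< cross (*-monoʳ-≤ p′ p≤q))

m+n≤1+g⇒m≤g : ∀ {m n g} → 0 < n → m + n ≤ suc g → m ≤ g
m+n≤1+g⇒m≤g {m} {n} 0<n m+n≤1+g =
  ≤-pred (≤-trans (subst (_≤ m + n) (+-comm m 1) (+-monoʳ-≤ m 0<n)) m+n≤1+g)

euclid-≺ : ∀ {g g′ p q p′ q′} → 0 < p → 0 < q → 0 < p′ → 0 < q′ →
           p + q ≤ g → p′ + q′ ≤ g′ → p′ * q < p * q′ → euclid g′ p′ q′ ≺ euclid g p q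
euclid-≺ {zero}          (s≤s _) _ _       _ () _ _
euclid-≺ {suc g} {zero}  _       _ (s≤s _) _ _ () _
euclid-≺ {suc g} {suc g′} {p} {q} {p′} {q′} 0<p 0<q 0<p′ 0<q′ fuel fuel′ cross
  with <-cmp p q | <-cmp p′ q′
... | tri> _ _ q<p | tri> _ _ q′<p′ =
  step up (euclid-≺ (m<n⇒0<n∸m q<p) 0<q (m<n⇒0<n∸m q′<p′) 0<q′
    (subst (_≤ g) (sym (m∸n+n≡m (<⇒≤ q<p))) (m+n≤1+g⇒m≤g 0<q fuel))
    (subst (_≤ g′) (sym (m∸n+n≡m (<⇒≤ q′<p′))) (m+n≤1+g⇒m≤g 0<q′ fuel′))
    (cross-∸ˡ {p} {q} {p′} {q′} (<⇒≤ q′<p′) cross))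
... | tri> _ _ _ | tri≈ _ _ _ = []≺up
... | tri> _ _ _ | tri< _ _ _ = right≺up
... | tri≈ _ _ _ | tri< _ _ _ = right≺[]
... | tri< p<q _ _ | tri< p′<q′ _ _ =
  step right (euclid-≺ 0<p (m<n⇒0<n∸m p<q) 0<p′ (m<n⇒0<n∸m p′<q′)
    (subst (_≤ g) (sym (m+[n∸m]≡n (<⇒≤ p<q)))
       (m+n≤1+g⇒m≤g 0<p (subst (_≤ suc g) (+-comm p q) fuel)))
    (subst (_≤ g′) (sym (m+[n∸m]≡n (<⇒≤ p′<q′)))
       (m+n≤1+g⇒m≤g 0<p′ (subst (_≤ suc g′) (+-comm p′ q′) fuel′)))
    (cross-∸ʳ {p} {q} {p′} {q′} (<⇒≤ p<q) cross))
... | tri≈ _ _ q≮p | tri≈ p′≮q′ _ _ = contradiction cross (cross-contradiction {p} {q} {p′} {q′} (≮⇒≥ q≮p) (≮⇒≥ p′≮q′))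
... | tri≈ _ _ q≮p | tri> p′≮q′ _ _ = contradiction cross (cross-contradiction {p} {q} {p′} {q′} (≮⇒≥ q≮p) (≮⇒≥ p′≮q′))
... | tri< _ _ q≮p | tri≈ p′≮q′ _ _ = contradiction cross (cross-contradiction {p} {q} {p′} {q′} (≮⇒≥ q≮p) (≮⇒≥ p′≮q′))
... | tri< _ _ q≮p | tri> p′≮q′ _ _ = contradiction cross (cross-contradiction {p} {q} {p′} {q′} (≮⇒≥ q≮p) (≮⇒≥ p′≮q′))

-- Continued fractions

tailSteps-flip : ∀ d as → tailSteps (flipDir d) as ≡ map flipDir (tailSteps d as)
tailSteps-flip d []          = sym (map-replicate flipDir 0 d)
tailSteps-flip d (x ∷ [])    = sym (map-replicate flipDir (x ∸ 1) d)
tailSteps-flip d (x ∷ y ∷ r) = begin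
  replicate x (flipDir d) ++ tailSteps (flipDir (flipDir d)) (y ∷ r)
    ≡⟨ cong₂ _++_ (sym (map-replicate flipDir x d)) (tailSteps-flip (flipDir d) (y ∷ r)) ⟩
  map flipDir (replicate x d) ++ map flipDir (tailSteps (flipDir d) (y ∷ r))
    ≡⟨ sym (map-++ flipDir (replicate x d) _) ⟩
  map flipDir (replicate x d ++ tailSteps (flipDir d) (y ∷ r))
    ∎

stripSteps-tailSteps : ∀ {a} L → 0 < a → stripSteps (a ∷ L) ≡ drop 1 (tailSteps up (a ∷ L))
stripSteps-tailSteps {suc zero}    []      _ = refl
stripSteps-tailSteps {suc (suc a)} []      _ = refl
stripSteps-tailSteps {suc a}       (b ∷ L) _ = refl

data PositiveHead : List ℕ → Set where
  positive∷ : ∀ {a} L → 0 < a → PositiveHead (a ∷ L)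

cfAux-PositiveHead : ∀ {f p q} → 0 < q → q ≤ f → q ≤ p → PositiveHead (cfAux f p q)
cfAux-PositiveHead {suc f} {p} {suc q} _ _ q≤p with p % suc q
... | zero  = positive∷ [] (m≥n⇒m/n>0 q≤p)
... | suc r = positive∷ (cfAux f (suc q) (suc r)) (m≥n⇒m/n>0 q≤p)

MatchesEuclid : ℕ → ℕ → ℕ → List ℕ → Set
MatchesEuclid g p q L = tailSteps up L ≡ euclid g p q × sum L ≡ suc (length (euclid g p q))

[a]-MatchesEuclid : ∀ a {p q g} → 0 < a → 0 < q → p ≡ a * q → p + q ≤ g →
                    MatchesEuclid g p q (a ∷ [])
[a]-MatchesEuclid (suc a) {q = q} {g} _ 0<q refl p+q≤g =
  sym run , cong suc (trans (+-identityʳ a) (trans (sym (length-replicate a)) (cong length (sym run))))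
  where
  run : euclid g (suc a * q) q ≡ replicate a up
  run = trans (cong (λ n → euclid g n q) (+-comm q (a * q)))
              (euclid-multiple a 0<q (subst (_≤ g) (+-comm q (a * q)) (m+n≤o⇒m≤o (suc a * q) p+q≤g)))

∷-MatchesEuclid : ∀ a {p q r g L} → p ≡ r + a * q → 0 < r → 0 < q → p + q ≤ g → PositiveHead L →
  (∀ {g′} → q + r ≤ g′ → MatchesEuclid g′ q r L) → MatchesEuclid g p q (a ∷ L)
∷-MatchesEuclid a {p} {q} {r} {g} p≡ 0<r 0<q p+q≤g (positive∷ {c} L _) tail-matches = steps , total
  where
  E : List Dir
  E = euclid (g ∸ a) q r

  a≤aq : a ≤ a * q
  a≤aq = m≤m*n a q {{>-nonZero 0<q}}

  a≤g : a ≤ g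
  a≤g = ≤-trans a≤aq (≤-trans (m≤n+m (a * q) r)
                                (≤-trans (≤-reflexive (sym p≡)) (m+n≤o⇒m≤o p p+q≤g)))

  tail-bound : q + r ≤ g ∸ a
  tail-bound = m+n≤o⇒m≤o∸n (q + r) (≤-trans (≤-reflexive (reorder q r a))
    (≤-trans (+-monoˡ-≤ q (+-monoʳ-≤ r a≤aq)) (subst (λ n → n + q ≤ g) p≡ p+q≤g)))
    where
    reorder : ∀ q r a → q + r + a ≡ r + a + q
    reorder = solve-∀

  tail-steps : tailSteps up (c ∷ L) ≡ E
  tail-steps = proj₁ (tail-matches tail-bound)

  tail-total : sum (c ∷ L) ≡ suc (length E)
  tail-total = proj₂ (tail-matches tail-bound)

  run : euclid g p q ≡ replicate a up ++ map flipDir E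
  run = trans (cong (λ n → euclid g n q) (trans p≡ (+-comm r (a * q))))
              (trans (euclid-up-run a 0<r a≤g) (cong (replicate a up ++_) (euclid-flip (g ∸ a) q r)))

  steps : replicate a up ++ tailSteps right (c ∷ L) ≡ euclid g p q
  steps = begin
    replicate a up ++ tailSteps right (c ∷ L)
      ≡⟨ cong (replicate a up ++_) (tailSteps-flip up (c ∷ L)) ⟩
    replicate a up ++ map flipDir (tailSteps up (c ∷ L))
      ≡⟨ cong (λ w → replicate a up ++ map flipDir w) tail-steps ⟩
    replicate a up ++ map flipDir E
      ≡⟨ sym run ⟩
    euclid g p q
      ∎

  total : a + sum (c ∷ L) ≡ suc (length (euclid g p q))
  total = begin
    a + sum (c ∷ L)
      ≡⟨ cong (a +_) tail-total ⟩
    a + suc (length E)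
      ≡⟨ +-suc a (length E) ⟩
    suc (a + length E)
      ≡⟨ cong suc (sym (cong₂ _+_ (length-replicate a) (length-map flipDir E))) ⟩
    suc (length (replicate a up) + length (map flipDir E))
      ≡⟨ cong suc (sym (length-++ (replicate a up))) ⟩
    suc (length (replicate a up ++ map flipDir E))
      ≡⟨ cong (suc ∘ length) (sym run) ⟩
    suc (length (euclid g p q))
      ∎

cfAux-MatchesEuclid : ∀ f {p q} → 0 < q → q ≤ p → q ≤ f → ∀ {g} → p + q ≤ g →
                      MatchesEuclid g p q (cfAux f p q)
cfAux-MatchesEuclid (suc f) {p} {suc q} 0<q q≤p q≤f p+q≤g
  with p % suc q | m≡m%n+[m/n]*n p (suc q) | m%n<n p (suc q)
... | zero  | p≡ | _   = [a]-MatchesEuclid (p / suc q) (m≥n⇒m/n>0 q≤p) 0<q p≡ p+q≤g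
... | suc r | p≡ | r<q =
  ∷-MatchesEuclid (p / suc q) p≡ z<s 0<q p+q≤g (cfAux-PositiveHead z<s r<f (<⇒≤ r<q))
    (cfAux-MatchesEuclid f z<s (<⇒≤ r<q) r<f)
  where
  r<f : suc r ≤ f
  r<f = ≤-trans (≤-pred r<q) (≤-pred q≤f)

𝒢[cfAux] : ∀ {p q} → 0 < q → q ≤ p →
  𝒢[ cfAux (suc q) p q ] ≡ strip (length (euclid (p + q) p q)) (drop 1 (euclid (p + q) p q))
𝒢[cfAux] {p} {q} 0<q q≤p
  with cfAux (suc q) p q
     | cfAux-PositiveHead 0<q (n≤1+n q) q≤p
     | cfAux-MatchesEuclid (suc q) 0<q q≤p (n≤1+n q) ≤-refl
... | _ | positive∷ L 0<a | steps , total =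
  cong₂ strip (cong (_∸ 1) total) (trans (stripSteps-tailSteps L 0<a) (cong (drop 1) steps))

word : ℚ → List Dir
word x = euclid (ℤ.∣ ↥ x ∣ + ↧ₙ x) ℤ.∣ ↥ x ∣ (↧ₙ x)

1≤ℚ⇒↧≤↥ : ∀ {x} → 1ℚ ≤ℚ x → ↧ₙ x ≤ ℤ.∣ ↥ x ∣
1≤ℚ⇒↧≤↥ {mkℚ (ℤ.+ p) d _}     (*≤* 1≤x) =
  ℤ.drop‿+≤+ (subst₂ ℤ._≤_ (ℤ.*-identityˡ _) (ℤ.*-identityʳ _) 1≤x)
1≤ℚ⇒↧≤↥ {mkℚ ℤ.-[1+ n ] d _} (*≤* ())

<ℚ⇒cross-< : ∀ {x y} → 1ℚ ≤ℚ y → y <ℚ x → ℤ.∣ ↥ y ∣ * ↧ₙ x < ℤ.∣ ↥ x ∣ * ↧ₙ y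
<ℚ⇒cross-< {mkℚ (ℤ.+ p) dx _} {mkℚ (ℤ.+ p′) dy _} _ (*<* y<x) =
  ℤ.drop‿+<+ (subst₂ ℤ._<_ (sym (ℤ.pos-* p′ (suc dx))) (sym (ℤ.pos-* p (suc dy))) y<x)
<ℚ⇒cross-< {mkℚ ℤ.-[1+ n ] dx _} {mkℚ (ℤ.+ p′) dy _} _ (*<* y<x)
  with () ← subst (ℤ._< ℤ.-[1+ n ] ℤ.* ℤ.+ suc dy) (sym (ℤ.pos-* p′ (suc dx))) y<x
<ℚ⇒cross-< {y = mkℚ ℤ.-[1+ n ] dy _} (*≤* ()) _

𝒢-word : ∀ {x} → 1ℚ ≤ℚ x → 𝒢 x ≡ strip (length (word x)) (drop 1 (word x))
𝒢-word 1≤x = 𝒢[cfAux] z<s (1≤ℚ⇒↧≤↥ 1≤x)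

word-UpOrEmpty : ∀ {x} → 1ℚ ≤ℚ x → UpOrEmpty (word x)
word-UpOrEmpty {x} 1≤x = euclid-UpOrEmpty (ℤ.∣ ↥ x ∣ + ↧ₙ x) (1≤ℚ⇒↧≤↥ 1≤x)

word-≺ : ∀ {x y} → 1ℚ ≤ℚ y → y <ℚ x → word y ≺ word x
word-≺ 1≤y y<x =
  euclid-≺ (<-≤-trans z<s (1≤ℚ⇒↧≤↥ (ℚ.≤-trans 1≤y (ℚ.<⇒≤ y<x)))) z<s
           (<-≤-trans z<s (1≤ℚ⇒↧≤↥ 1≤y)) z<s
           ≤-refl ≤-refl (<ℚ⇒cross-< 1≤y y<x)

-- P-partitions of border strips

<ᵇ-suc : ∀ v k → (v <ᵇ suc k) ≡ (v ≤ᵇ k)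
<ᵇ-suc zero    k = refl
<ᵇ-suc (suc v) k = refl

+-≡ᵇ : ∀ v s k → (v + s ≡ᵇ k) ≡ (v ≤ᵇ k) ∧ (s ≡ᵇ k ∸ v)
+-≡ᵇ zero    s k       = refl
+-≡ᵇ (suc v) s zero    = refl
+-≡ᵇ (suc v) s (suc k) = trans (+-≡ᵇ v s k) (cong (_∧ (s ≡ᵇ k ∸ v)) (sym (<ᵇ-suc v k)))

firstSatisfies : (ℕ → Bool) → List ℕ → Bool
firstSatisfies p []      = true
firstSatisfies p (u ∷ _) = p u

module PPartitions (m : ℕ) where

  values : List ℕ
  values = upTo (suc m)

  -- Φ w v: the P-partitions with parts ≤ m of the strip with step word w (and 1 + length w boxes)
  -- whose first box has value v.
  Φ : List Dir → ℕ → Series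
  Φ []       v = shift v δ
  Φ (d ∷ ds) v = shift v (sumIf values (stepOK d v) (Φ ds))

  Φ-ratio : ∀ {xs ys} → ys ≺ xs → RatioMonotone (Φ xs) (Φ ys)
  Φ-ratio (step d ys≺xs) =
    RatioMonotone-shift (λ b<a → sumIf-ratio-≤ values (stepOK-swapClosed d b<a) (Φ-ratio ys≺xs))
  Φ-ratio {up ∷ xs} {right ∷ ys} right≺up =
    RatioMonotone-shift (mono-anti⇒RatioMonotone (sumIf-up-mono values (Φ xs)) (sumIf-right-anti values (Φ ys)))
  Φ-ratio {[]} {right ∷ ys} right≺[] =
    RatioMonotone-shift (mono-anti⇒RatioMonotone (λ _ _ → ≤-refl) (sumIf-right-anti values (Φ ys)))
  Φ-ratio {up ∷ xs} {[]} []≺up =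
    RatioMonotone-shift (mono-anti⇒RatioMonotone (sumIf-up-mono values (Φ xs)) (λ _ _ → ≤-refl))

  ∑-allMaps-suc : ∀ N (h : List ℕ → ℕ) →
                  ∑ (allMaps m (suc N)) h ≡ ∑ values (λ v → ∑ (allMaps m N) (h ∘ (v ∷_)))
  ∑-allMaps-suc N h = trans (∑-concatMap values (λ v → map (v ∷_) (allMaps m N)) h)
                            (∑-cong values (λ v → ∑-map (allMaps m N) (v ∷_) h))

  ∑-allMaps-cong : ∀ N {h h′ : List ℕ → ℕ} → (∀ v σ → h (v ∷ σ) ≡ h′ (v ∷ σ)) →
                   ∑ (allMaps m (suc N)) h ≡ ∑ (allMaps m (suc N)) h′
  ∑-allMaps-cong N {h} {h′} h≗h′ = begin
    ∑ (allMaps m (suc N)) h                        ≡⟨ ∑-allMaps-suc N h ⟩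
    ∑ values (λ v → ∑ (allMaps m N) (h ∘ (v ∷_)))  ≡⟨ ∑-cong values (λ v → ∑-cong (allMaps m N) (h≗h′ v)) ⟩
    ∑ values (λ v → ∑ (allMaps m N) (h′ ∘ (v ∷_))) ≡⟨ sym (∑-allMaps-suc N h′) ⟩
    ∑ (allMaps m (suc N)) h′                       ∎

  Admissible : List Dir → (ℕ → Bool) → ℕ → List ℕ → Bool
  Admissible w p k σ = (sum σ ≡ᵇ k) ∧ monotone w σ ∧ firstSatisfies p σ ∧ lastLE m σ

  Admissible-∷ : ∀ d ds p k v u τ →
    Admissible (d ∷ ds) p k (v ∷ u ∷ τ) ≡ (p v ∧ (v ≤ᵇ k)) ∧ Admissible ds (stepOK d v) (k ∸ v) (u ∷ τ)
  Admissible-∷ d ds p k v u τ rewrite +-≡ᵇ v (u + sum τ) k =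
    solve 6 (λ a b c d e f → (a ⊕ b) ⊕ ((c ⊕ d) ⊕ (e ⊕ f)) ⊜ (e ⊕ a) ⊕ (b ⊕ (d ⊕ (c ⊕ f)))) refl
      (v ≤ᵇ k) (u + sum τ ≡ᵇ k ∸ v) (stepOK d v u) (monotone ds (u ∷ τ)) (p v) (lastLE m (u ∷ τ))

  ∑-Admissible : ∀ w p k →
    ∑ (allMaps m (suc (length w))) (λ σ → Admissible w p k σ ⋆ 1) ≡ sumIf values p (Φ w) k
  ∑-Admissible [] p k =
    trans (∑-allMaps-suc 0 _) (cong sum (map-cong-local (applyUpTo⁺₁ id (suc m) one-box)))
    where
    one-box : ∀ {v} → v < suc m → Admissible [] p k (v ∷ []) ⋆ 1 + 0 ≡ p v ⋆ shift v δ k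
    one-box {v} (s≤s v≤m) rewrite +-identityʳ v | Equivalence.to T-≡ (≤⇒≤ᵇ v≤m) | shift-δ v k
      with v ≡ᵇ k | p v
    ... | true  | true  = refl
    ... | true  | false = refl
    ... | false | true  = refl
    ... | false | false = refl
  ∑-Admissible (d ∷ ds) p k = begin
    ∑ (allMaps m (2 + n)) (λ σ → Admissible (d ∷ ds) p k σ ⋆ 1)
      ≡⟨ ∑-allMaps-suc (suc n) _ ⟩
    ∑ values (λ v → ∑ (allMaps m (suc n)) (λ σ → Admissible (d ∷ ds) p k (v ∷ σ) ⋆ 1))
      ≡⟨ ∑-cong values (λ v → ∑-allMaps-cong n (λ u τ →
           trans (cong (_⋆ 1) (Admissible-∷ d ds p k v u τ)) (sym (⋆-∧ (p v ∧ (v ≤ᵇ k)) _ 1)))) ⟩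
    ∑ values (λ v → ∑ (allMaps m (suc n)) (λ σ → (p v ∧ (v ≤ᵇ k)) ⋆ (tail v σ ⋆ 1)))
      ≡⟨ ∑-cong values (λ v → sym (⋆-∑ (p v ∧ (v ≤ᵇ k)) (allMaps m (suc n)) _)) ⟩
    ∑ values (λ v → (p v ∧ (v ≤ᵇ k)) ⋆ ∑ (allMaps m (suc n)) (λ σ → tail v σ ⋆ 1))
      ≡⟨ ∑-cong values (λ v → cong ((p v ∧ (v ≤ᵇ k)) ⋆_) (∑-Admissible ds (stepOK d v) (k ∸ v))) ⟩
    ∑ values (λ v → (p v ∧ (v ≤ᵇ k)) ⋆ sumIf values (stepOK d v) (Φ ds) (k ∸ v))
      ≡⟨ ∑-cong values (λ v → trans (sym (⋆-∧ (p v) (v ≤ᵇ k) _))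
                                     (cong (p v ⋆_) (sym (shift-≤ᵇ v _ k)))) ⟩
    sumIf values p (Φ (d ∷ ds)) k
      ∎
    where
    n : ℕ
    n = length ds
    tail : ℕ → List ℕ → Bool
    tail v = Admissible ds (stepOK d v) (k ∸ v)

  Ω-strip : ∀ {c} w → c ≤ m →
            Ω m (suc m ∸ c) 1 (strip (suc (length w)) w) ≗ sumIf values (_≤ᵇ c) (Φ w)
  Ω-strip {c} w c≤m k = begin
    Ω m (suc m ∸ c) 1 (strip (suc (length w)) w) k
      ≡⟨ length-filterᵇ _ (allMaps m (suc (length w))) ⟩
    ∑ (allMaps m (suc (length w)))
      (λ σ → ((sum σ ≡ᵇ k) ∧ monotone w σ ∧ firstLE (suc m ∸ (suc m ∸ c)) σ ∧ lastLE m σ) ⋆ 1)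
      ≡⟨ ∑-allMaps-cong (length w) (λ v σ →
           cong (λ c′ → ((v + sum σ ≡ᵇ k) ∧ monotone w (v ∷ σ) ∧ (v ≤ᵇ c′) ∧ lastLE m (v ∷ σ)) ⋆ 1)
             (m∸[m∸n]≡n (m≤n⇒m≤1+n c≤m))) ⟩
    ∑ (allMaps m (suc (length w))) (λ σ → Admissible w (_≤ᵇ c) k σ ⋆ 1)
      ≡⟨ ∑-Admissible w (_≤ᵇ c) k ⟩
    sumIf values (_≤ᵇ c) (Φ w) k
      ∎

  Ω-empty : ∀ i j → Ω m i j (strip 0 []) ≗ δ
  Ω-empty i j zero    = refl
  Ω-empty i j (suc k) = refl

  Φ-Ω : ∀ {c e} → c ≤ m → UpOrEmpty e →
        Φ e c ≗ shift c (Ω m (suc m ∸ c) 1 (strip (length e) (drop 1 e)))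
  Φ-Ω {c} c≤m []      = shift-cong c (λ k → sym (Ω-empty (suc m ∸ c) 1 k))
  Φ-Ω {c} c≤m (up∷ w) = shift-cong c (λ k → sym (Ω-strip w c≤m k))

  Φ-word : ∀ {x c} → 1ℚ ≤ℚ x → c ≤ m → Φ (word x) c ≗ shift c (Ω m (suc m ∸ c) 1 (𝒢 x))
  Φ-word {x} {c} 1≤x c≤m k =
    subst (λ G → Φ (word x) c k ≡ shift c (Ω m (suc m ∸ c) 1 G) k) (sym (𝒢-word 1≤x))
      (Φ-Ω c≤m (word-UpOrEmpty 1≤x) k)

-- The argument does not need 1 ≤ m.
theoremC : (m i : ℕ) → 1 ≤ m → i ≤ m → (x y : ℚ) → 1ℚ ≤ℚ y → y <ℚ x →
    let R = Ω m (suc m ∸ i) 1 (𝒢 x)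
        S = Ω m (suc m) 1 (𝒢 x)
        A = Ω m (suc m ∸ i) 1 (𝒢 y)
        B = Ω m (suc m) 1 (𝒢 y)
    in (k : ℕ) → (A ⊛ S) k ≤ (R ⊛ B) k
theoremC m i _ i≤m x y 1≤y y<x =
  RatioMonotone-unshift {m} {Φ (word x)} {Φ (word y)}
                        {λ c → Ω m (suc m ∸ c) 1 (𝒢 x)} {λ c → Ω m (suc m ∸ c) 1 (𝒢 y)}
    (Φ-ratio (word-≺ 1≤y y<x)) (Φ-word (ℚ.≤-trans 1≤y (ℚ.<⇒≤ y<x))) (Φ-word 1≤y) i≤m
  where open PPartitions m
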